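{- Let $(P,\mathcal{L})$ be an $r$-uniform intersecting linear system with $\Delta(P,\mathcal{L})=2$. Then $$\tau(P,\mathcal{L})\leq \frac{|P|+|\mathcal{L}|}{r+1}.$$
   Context: A linear system is a pair $(P,\mathcal{L})$ where $P$ is a finite set (points) and $\mathcal{L}$ is a family of subsets of $P$ (lines) such that $|l\cap l'|\leq 1$ for all distinct $l,l'\in\mathcal{L}$; it is intersecting if $|l\cap l'|=1$ for all distinct $l,l'\in\mathcal{L}$, and $r$-uniform if every line has exactly $r$ points. The degree of a point is the number of lines containing it, and $\Delta(P,\mathcal{L})$ is the maximum degree. A transversal is a set $T\subseteq P$ meeting every line; $\tau(P,\mathcal{L})$ is the minimum size of a transversal. -}

module Defs where

open import Data.Nat using (ℕ; _≤_; _+_; _*_)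
open import Data.Fin using (Fin)
open import Data.Fin.Subset using (Subset; _∈_; _∩_; ∣_∣; Nonempty)
open import Data.Fin.Subset.Properties using (_∈?_)
open import Data.List using (List; length; filter)
open import Data.List.Membership.Propositional using () renaming (_∈_ to _∈ₗ_)
open import Data.List.Relation.Unary.All using (All)
open import Data.List.Relation.Unary.AllPairs using (AllPairs)
open import Data.List.Relation.Unary.Unique.Propositional using (Unique)
open import Data.Product using (Σ; _×_; ∃)
open import Relation.Binary.PropositionalEquality using (_≡_; _≢_)

-- A linear system on the point set P = Fin n, with line family given as a
-- duplicate-free list of subsets of P (so |𝓛| = length of the list).
record LinearSystem (n : ℕ) : Set where
  field
    lines    : List (Subset n)
    distinct : Unique lines
    linear   : AllPairs (λ l l′ → ∣ l ∩ l′ ∣ ≤ 1) lines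

open LinearSystem public

Intersecting : ∀ {n} → LinearSystem n → Set
Intersecting S = AllPairs (λ l l′ → ∣ l ∩ l′ ∣ ≡ 1) (lines S)

Uniform : ∀ {n} → ℕ → LinearSystem n → Set
Uniform r S = All (λ l → ∣ l ∣ ≡ r) (lines S)

degree : ∀ {n} → LinearSystem n → Fin n → ℕ
degree S p = length (filter (p ∈?_) (lines S))

MaxDegree : ∀ {n} → LinearSystem n → ℕ → Set
MaxDegree S d = (∃ λ p → degree S p ≡ d) × (∀ p → degree S p ≤ d)

Transversal : ∀ {n} → LinearSystem n → Subset n → Set
Transversal S T = ∀ l → l ∈ₗ lines S → Nonempty (T ∩ l)

IsTau : ∀ {n} → LinearSystem n → ℕ → Set
IsTau S t = (Σ (Subset _) λ T → Transversal S T × ∣ T ∣ ≡ t)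
          × (∀ T → Transversal S T → t ≤ ∣ T ∣)

-- Let m = |𝓛|. Since every point lies on at most two lines, the other m − 1 lines
-- meet a fixed line l in distinct points of l, so m ≤ r + 1. Pairing up the lines
-- and taking one intersection point per pair gives a transversal of size ⌈m/2⌉.
-- Bonferroni's inequality |⋃ ls| ≥ Σ |l| − Σ |l ∩ l′|, stated without subtraction.
-- |P| ≥ m r − C(m,2). Finally C(m,2) ≤ ⌊m/2⌋ m ≤ ⌊m/2⌋ (r + 1), and these combine to
-- ⌈m/2⌉ (r + 1) ≤ |P| + m.
module Submission where

open import Defs
open import Data.Bool using (true; false)
open import Data.Empty using (⊥-elim)
open import Data.Fin using (Fin; zero; suc)
open import Data.Fin.Subset
open import Data.Fin.Subset.Properties
open import Data.List using (List; []; _∷_; length; filter)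
open import Data.List.Properties using (length-filter; filter-accept)
open import Data.List.Relation.Unary.All as All using (All; []; _∷_)
open import Data.List.Relation.Unary.AllPairs as AllPairs using (AllPairs; []; _∷_)
open import Data.Nat using (ℕ; zero; suc; _≤_; _<_; _+_; _*_; z≤n; s≤s; ⌊_/2⌋; ⌈_/2⌉)
open import Data.Nat.Combinatorics using (_C_; nC1≡n; nCk+nC[k+1]≡[n+1]C[k+1])
open import Data.Nat.Properties
open import Data.Nat.Tactic.RingSolver using (solve-∀)
open import Data.Product using (_,_; _×_; ∃)
open import Data.Sum using (inj₁; inj₂)
open import Data.Vec using ([]; _∷_; here; there)
open import Relation.Binary.PropositionalEquality
open import Relation.Nullary using (yes; no)

private
  variable
    n : ℕ

∣p∪q∣+∣p∩q∣≡∣p∣+∣q∣ : (p q : Subset n) → ∣ p ∪ q ∣ + ∣ p ∩ q ∣ ≡ ∣ p ∣ + ∣ q ∣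
∣p∪q∣+∣p∩q∣≡∣p∣+∣q∣ [] [] = refl
∣p∪q∣+∣p∩q∣≡∣p∣+∣q∣ (true ∷ p) (true ∷ q) =
  cong suc (trans (+-suc _ _) (trans (cong suc (∣p∪q∣+∣p∩q∣≡∣p∣+∣q∣ p q)) (sym (+-suc _ _))))
∣p∪q∣+∣p∩q∣≡∣p∣+∣q∣ (true ∷ p) (false ∷ q) = cong suc (∣p∪q∣+∣p∩q∣≡∣p∣+∣q∣ p q)
∣p∪q∣+∣p∩q∣≡∣p∣+∣q∣ (false ∷ p) (true ∷ q) = trans (cong suc (∣p∪q∣+∣p∩q∣≡∣p∣+∣q∣ p q)) (sym (+-suc _ _))
∣p∪q∣+∣p∩q∣≡∣p∣+∣q∣ (false ∷ p) (false ∷ q) = ∣p∪q∣+∣p∩q∣≡∣p∣+∣q∣ p q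

∣p∪q∣≤∣p∣+∣q∣ : (p q : Subset n) → ∣ p ∪ q ∣ ≤ ∣ p ∣ + ∣ q ∣
∣p∪q∣≤∣p∣+∣q∣ p q = ≤-trans (m≤m+n _ _) (≤-reflexive (∣p∪q∣+∣p∩q∣≡∣p∣+∣q∣ p q))

Empty[p∩q]⇒∣p∪q∣≡∣p∣+∣q∣ : (p q : Subset n) → Empty (p ∩ q) → ∣ p ∪ q ∣ ≡ ∣ p ∣ + ∣ q ∣
Empty[p∩q]⇒∣p∪q∣≡∣p∣+∣q∣ {n} p q disjoint = begin
  ∣ p ∪ q ∣             ≡⟨ +-identityʳ ∣ p ∪ q ∣ ⟨
  ∣ p ∪ q ∣ + 0         ≡⟨ cong (∣ p ∪ q ∣ +_) (∣⊥∣≡0 n) ⟨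
  ∣ p ∪ q ∣ + ∣ ⊥ {n = n} ∣ ≡⟨ cong (λ s → ∣ p ∪ q ∣ + ∣ s ∣) (Empty-unique disjoint) ⟨
  ∣ p ∪ q ∣ + ∣ p ∩ q ∣ ≡⟨ ∣p∪q∣+∣p∩q∣≡∣p∣+∣q∣ p q ⟩
  ∣ p ∣ + ∣ q ∣         ∎
  where open ≡-Reasoning

0<∣p∣⇒Nonempty : (p : Subset n) → 0 < ∣ p ∣ → Nonempty p
0<∣p∣⇒Nonempty (true ∷ p) _ = zero , here
0<∣p∣⇒Nonempty (false ∷ p) 0<∣p∣ with 0<∣p∣⇒Nonempty p 0<∣p∣
... | x , x∈p = suc x , there x∈p

∣p∩q∣≡1⇒Nonempty : (p q : Subset n) → ∣ p ∩ q ∣ ≡ 1 → Nonempty (p ∩ q)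
∣p∩q∣≡1⇒Nonempty p q ∣p∩q∣≡1 = 0<∣p∣⇒Nonempty (p ∩ q) (≤-reflexive (sym ∣p∩q∣≡1))

Nonempty[∩]-monoˡ : {p q l : Subset n} → p ⊆ q → Nonempty (p ∩ l) → Nonempty (q ∩ l)
Nonempty[∩]-monoˡ {p = p} {l = l} p⊆q (x , x∈p∩l) with x∈p∩q⁻ p l x∈p∩l
... | x∈p , x∈l = x , x∈p∩q⁺ (p⊆q x∈p , x∈l)

degreeIn : Fin n → List (Subset n) → ℕ
degreeIn x ls = length (filter (x ∈?_) ls)

degreeIn-∷-∈ : (x : Fin n) {l : Subset n} (ls : List (Subset n)) →
               x ∈ l → degreeIn x (l ∷ ls) ≡ suc (degreeIn x ls)
degreeIn-∷-∈ x ls x∈l = cong length (filter-accept (x ∈?_) x∈l)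

degreeIn-∷-≤ : (x : Fin n) (l : Subset n) (ls : List (Subset n)) → degreeIn x ls ≤ degreeIn x (l ∷ ls)
degreeIn-∷-≤ x l ls with x ∈? l
... | yes _ = n≤1+n _
... | no  _ = ≤-refl

∈⋃⇒0<degreeIn : (x : Fin n) (ls : List (Subset n)) → x ∈ ⋃ ls → 0 < degreeIn x ls
∈⋃⇒0<degreeIn x [] x∈⊥ = ⊥-elim (∉⊥ x∈⊥)
∈⋃⇒0<degreeIn x (l ∷ ls) x∈⋃ with x∈p∪q⁻ l (⋃ ls) x∈⋃
... | inj₁ x∈l = ≤-trans (s≤s z≤n) (≤-reflexive (sym (degreeIn-∷-∈ x ls x∈l)))
... | inj₂ x∈⋃ls = ≤-trans (∈⋃⇒0<degreeIn x ls x∈⋃ls) (degreeIn-∷-≤ x l ls)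

∣l∩⋃ls∣≤length : (l : Subset n) (ls : List (Subset n)) →
                 All (λ l′ → ∣ l ∩ l′ ∣ ≤ 1) ls → ∣ l ∩ ⋃ ls ∣ ≤ length ls
∣l∩⋃ls∣≤length {n} l [] [] = ≤-reflexive (trans (cong ∣_∣ (∩-zeroʳ l)) (∣⊥∣≡0 n))
∣l∩⋃ls∣≤length l (l′ ∷ ls) (∣l∩l′∣≤1 ∷ meets) = begin
  ∣ l ∩ (l′ ∪ ⋃ ls) ∣          ≡⟨ cong ∣_∣ (∩-distribˡ-∪ l l′ (⋃ ls)) ⟩
  ∣ l ∩ l′ ∪ l ∩ ⋃ ls ∣        ≤⟨ ∣p∪q∣≤∣p∣+∣q∣ (l ∩ l′) (l ∩ ⋃ ls) ⟩
  ∣ l ∩ l′ ∣ + ∣ l ∩ ⋃ ls ∣    ≤⟨ +-mono-≤ ∣l∩l′∣≤1 (∣l∩⋃ls∣≤length l ls meets) ⟩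
  suc (length ls)              ∎
  where open ≤-Reasoning

-- The lines meet l in pairwise distinct points, since a common one would lie on two of them.
length≤∣l∩⋃ls∣ : (l : Subset n) (ls : List (Subset n)) → All (λ l′ → ∣ l ∩ l′ ∣ ≡ 1) ls →
                 (∀ x → x ∈ l → degreeIn x ls ≤ 1) → length ls ≤ ∣ l ∩ ⋃ ls ∣
length≤∣l∩⋃ls∣ l [] [] _ = z≤n
length≤∣l∩⋃ls∣ l (l′ ∷ ls) (∣l∩l′∣≡1 ∷ meets) degree≤1 = begin
  suc (length ls)              ≤⟨ s≤s (length≤∣l∩⋃ls∣ l ls meets degree≤1-ls) ⟩
  suc ∣ l ∩ ⋃ ls ∣             ≡⟨ cong (_+ ∣ l ∩ ⋃ ls ∣) ∣l∩l′∣≡1 ⟨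
  ∣ l ∩ l′ ∣ + ∣ l ∩ ⋃ ls ∣    ≡⟨ Empty[p∩q]⇒∣p∪q∣≡∣p∣+∣q∣ (l ∩ l′) (l ∩ ⋃ ls) disjoint ⟨
  ∣ l ∩ l′ ∪ l ∩ ⋃ ls ∣        ≡⟨ cong ∣_∣ (∩-distribˡ-∪ l l′ (⋃ ls)) ⟨
  ∣ l ∩ (l′ ∪ ⋃ ls) ∣          ∎
  where
  open ≤-Reasoning
  degree≤1-ls : ∀ x → x ∈ l → degreeIn x ls ≤ 1
  degree≤1-ls x x∈l = ≤-trans (degreeIn-∷-≤ x l′ ls) (degree≤1 x x∈l)
  disjoint : Empty ((l ∩ l′) ∩ (l ∩ ⋃ ls))
  disjoint (x , x∈both) with x∈p∩q⁻ (l ∩ l′) (l ∩ ⋃ ls) x∈both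
  ... | x∈l∩l′ , x∈l∩⋃ls with x∈p∩q⁻ l l′ x∈l∩l′ | x∈p∩q⁻ l (⋃ ls) x∈l∩⋃ls
  ... | x∈l , x∈l′ | _ , x∈⋃ls = <-irrefl refl (begin-strict
    1                          <⟨ s≤s (∈⋃⇒0<degreeIn x ls x∈⋃ls) ⟩
    suc (degreeIn x ls)        ≡⟨ degreeIn-∷-∈ x ls x∈l′ ⟨
    degreeIn x (l′ ∷ ls)       ≤⟨ degree≤1 x x∈l ⟩
    1                          ∎)

length≤1+lineSize : ∀ {r} (ls : List (Subset n)) → All (λ l → ∣ l ∣ ≡ r) ls →
                  AllPairs (λ l l′ → ∣ l ∩ l′ ∣ ≡ 1) ls → (∀ x → degreeIn x ls ≤ 2) → length ls ≤ suc r
length≤1+lineSize [] _ _ _ = z≤n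
length≤1+lineSize {r = r} (l ∷ ls) (∣l∣≡r ∷ _) (meets ∷ _) degree≤2 = s≤s (begin
  length ls                ≤⟨ length≤∣l∩⋃ls∣ l ls meets degree≤1 ⟩
  ∣ l ∩ ⋃ ls ∣             ≤⟨ ∣p∩q∣≤∣p∣ l (⋃ ls) ⟩
  ∣ l ∣                    ≡⟨ ∣l∣≡r ⟩
  r                        ∎)
  where
  open ≤-Reasoning
  degree≤1 : ∀ x → x ∈ l → degreeIn x ls ≤ 1
  degree≤1 x x∈l = ≤-pred (≤-trans (≤-reflexive (sym (degreeIn-∷-∈ x ls x∈l))) (degree≤2 x))

[1+n]C2≡n+nC2 : ∀ k → suc k C 2 ≡ k + k C 2
[1+n]C2≡n+nC2 k = trans (sym (nCk+nC[k+1]≡[n+1]C[k+1] k 1)) (cong (_+ k C 2) (nC1≡n k))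

-- Bonferroni's inequality |⋃ ls| ≥ Σ |l| − Σ |l ∩ l′|, stated without subtraction.
length*r≤∣⋃∣+lengthC2 : ∀ {r} (ls : List (Subset n)) → AllPairs (λ l l′ → ∣ l ∩ l′ ∣ ≤ 1) ls →
                        All (λ l → ∣ l ∣ ≡ r) ls → length ls * r ≤ ∣ ⋃ ls ∣ + length ls C 2
length*r≤∣⋃∣+lengthC2 [] [] [] = z≤n
length*r≤∣⋃∣+lengthC2 {r = r} (l ∷ ls) (meets ∷ linear) (∣l∣≡r ∷ uniform) = begin
  r + k * r                                ≤⟨ +-monoʳ-≤ r (length*r≤∣⋃∣+lengthC2 ls linear uniform) ⟩
  r + (∣ ⋃ ls ∣ + k C 2)                   ≡⟨ +-assoc r _ _ ⟨
  r + ∣ ⋃ ls ∣ + k C 2                     ≡⟨ cong (λ s → s + ∣ ⋃ ls ∣ + k C 2) ∣l∣≡r ⟨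
  ∣ l ∣ + ∣ ⋃ ls ∣ + k C 2                 ≡⟨ cong (_+ k C 2) (∣p∪q∣+∣p∩q∣≡∣p∣+∣q∣ l (⋃ ls)) ⟨
  ∣ l ∪ ⋃ ls ∣ + ∣ l ∩ ⋃ ls ∣ + k C 2      ≤⟨ +-monoˡ-≤ (k C 2) (+-monoʳ-≤ _ (∣l∩⋃ls∣≤length l ls meets)) ⟩
  ∣ l ∪ ⋃ ls ∣ + k + k C 2                 ≡⟨ +-assoc ∣ l ∪ ⋃ ls ∣ k (k C 2) ⟩
  ∣ l ∪ ⋃ ls ∣ + (k + k C 2)               ≡⟨ cong (∣ l ∪ ⋃ ls ∣ +_) ([1+n]C2≡n+nC2 k) ⟨
  ∣ l ∪ ⋃ ls ∣ + suc k C 2                 ∎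
  where
  open ≤-Reasoning
  k = length ls

pairing-transversal : (ls : List (Subset n)) → AllPairs (λ l l′ → Nonempty (l ∩ l′)) ls → All Nonempty ls →
                      ∃ λ T → All (λ l → Nonempty (T ∩ l)) ls × ∣ T ∣ ≤ ⌈ length ls /2⌉
pairing-transversal {n} [] _ _ = ⊥ , [] , ≤-reflexive (∣⊥∣≡0 n)
pairing-transversal (l ∷ []) _ ((x , x∈l) ∷ []) =
  ⁅ x ⁆ , (x , x∈p∩q⁺ (x∈⁅x⁆ x , x∈l)) ∷ [] , ≤-reflexive (∣⁅x⁆∣≡1 x)
pairing-transversal (l ∷ l′ ∷ ls) (((x , x∈l∩l′) ∷ _) ∷ (_ ∷ meets)) (_ ∷ _ ∷ nonempty)
  with pairing-transversal ls meets nonempty | x∈p∩q⁻ l l′ x∈l∩l′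
... | T , hits , ∣T∣≤ | x∈l , x∈l′ =
  ⁅ x ⁆ ∪ T , hit x∈l ∷ hit x∈l′ ∷ All.map (Nonempty[∩]-monoˡ (q⊆p∪q ⁅ x ⁆ T)) hits , size
  where
  hit : ∀ {m} → x ∈ m → Nonempty ((⁅ x ⁆ ∪ T) ∩ m)
  hit x∈m = x , x∈p∩q⁺ (p⊆p∪q T (x∈⁅x⁆ x) , x∈m)
  size : ∣ ⁅ x ⁆ ∪ T ∣ ≤ suc ⌈ length ls /2⌉
  size = ≤-trans (∣p∪q∣≤∣p∣+∣q∣ ⁅ x ⁆ T) (≤-trans (≤-reflexive (cong (_+ ∣ T ∣) (∣⁅x⁆∣≡1 x))) (s≤s ∣T∣≤))

1≤lineSize : ∀ {r} (ls : List (Subset n)) → 2 ≤ length ls → All (λ l → ∣ l ∣ ≡ r) ls →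
             AllPairs (λ l l′ → ∣ l ∩ l′ ∣ ≡ 1) ls → 1 ≤ r
1≤lineSize (_ ∷ []) (s≤s ()) _ _
1≤lineSize (l ∷ l′ ∷ _) _ (∣l∣≡r ∷ _) ((∣l∩l′∣≡1 ∷ _) ∷ _) =
  ≤-trans (≤-reflexive (sym ∣l∩l′∣≡1)) (≤-trans (∣p∩q∣≤∣p∣ l l′) (≤-reflexive ∣l∣≡r))

n≤1+⌊n/2⌋+⌊n/2⌋ : ∀ n → n ≤ suc (⌊ n /2⌋ + ⌊ n /2⌋)
n≤1+⌊n/2⌋+⌊n/2⌋ zero = z≤n
n≤1+⌊n/2⌋+⌊n/2⌋ (suc zero) = s≤s z≤n
n≤1+⌊n/2⌋+⌊n/2⌋ (suc (suc n)) =
  s≤s (≤-trans (s≤s (n≤1+⌊n/2⌋+⌊n/2⌋ n)) (≤-reflexive (cong suc (sym (+-suc ⌊ n /2⌋ ⌊ n /2⌋)))))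

nC2≤⌊n/2⌋*n : ∀ n → n C 2 ≤ ⌊ n /2⌋ * n
nC2≤⌊n/2⌋*n zero = z≤n
nC2≤⌊n/2⌋*n (suc zero) = z≤n
nC2≤⌊n/2⌋*n (suc (suc n)) = begin
  suc (suc n) C 2                      ≡⟨ [1+n]C2≡n+nC2 (suc n) ⟩
  suc n + suc n C 2                    ≡⟨ cong (suc n +_) ([1+n]C2≡n+nC2 n) ⟩
  suc n + (n + n C 2)                  ≤⟨ +-monoʳ-≤ (suc n) (+-mono-≤ (n≤1+⌊n/2⌋+⌊n/2⌋ n) (nC2≤⌊n/2⌋*n n)) ⟩
  suc n + (suc (h + h) + h * n)        ≡⟨ expand h n ⟩
  suc h * suc (suc n)                  ∎
  where
  open ≤-Reasoning
  h = ⌊ n /2⌋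
  expand : ∀ h n → suc n + (suc (h + h) + h * n) ≡ suc h * suc (suc n)
  expand = solve-∀

⌈m/2⌉*s+mC2≤m*s : ∀ {m s} → m ≤ s → ⌈ m /2⌉ * s + m C 2 ≤ m * s
⌈m/2⌉*s+mC2≤m*s {m} {s} m≤s = begin
  ⌈ m /2⌉ * s + m C 2              ≤⟨ +-monoʳ-≤ (⌈ m /2⌉ * s) (nC2≤⌊n/2⌋*n m) ⟩
  ⌈ m /2⌉ * s + ⌊ m /2⌋ * m        ≤⟨ +-monoʳ-≤ (⌈ m /2⌉ * s) (*-monoʳ-≤ ⌊ m /2⌋ m≤s) ⟩
  ⌈ m /2⌉ * s + ⌊ m /2⌋ * s        ≡⟨ *-distribʳ-+ s ⌈ m /2⌉ ⌊ m /2⌋ ⟨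
  (⌈ m /2⌉ + ⌊ m /2⌋) * s          ≡⟨ cong (_* s) (trans (+-comm ⌈ m /2⌉ ⌊ m /2⌋) (⌊n/2⌋+⌈n/2⌉≡n m)) ⟩
  m * s                            ∎
  where open ≤-Reasoning

t*[1+r]≤n+m : ∀ {t m r n} → t ≤ ⌈ m /2⌉ → m ≤ suc r → m * r ≤ n + m C 2 → t * suc r ≤ n + m
t*[1+r]≤n+m {t} {m} {r} {n} t≤⌈m/2⌉ m≤1+r m*r≤n+mC2 = +-cancelʳ-≤ (m C 2) _ _ (begin
  t * suc r + m C 2                ≤⟨ +-monoˡ-≤ (m C 2) (*-monoˡ-≤ (suc r) t≤⌈m/2⌉) ⟩
  ⌈ m /2⌉ * suc r + m C 2          ≤⟨ ⌈m/2⌉*s+mC2≤m*s m≤1+r ⟩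
  m * suc r                        ≡⟨ *-suc m r ⟩
  m + m * r                        ≤⟨ +-monoʳ-≤ m m*r≤n+mC2 ⟩
  m + (n + m C 2)                  ≡⟨ +-assoc m n (m C 2) ⟨
  m + n + m C 2                    ≡⟨ cong (_+ m C 2) (+-comm m n) ⟩
  n + m + m C 2                    ∎)
  where open ≤-Reasoning

corollary2p7 : (n r : ℕ) (S : LinearSystem n) → Uniform r S → Intersecting S → MaxDegree S 2 →
    (t : ℕ) → IsTau S t → t * suc r ≤ n + length (lines S)
corollary2p7 n r S uniform intersecting ((x , degree[x]≡2) , degree≤2) t (_ , minimal) =
  t*[1+r]≤n+m τ≤⌈m/2⌉ (length≤1+lineSize (lines S) uniform intersecting degree≤2) counting
  where
  m = length (lines S)
  two-lines : 2 ≤ m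
  two-lines = ≤-trans (≤-reflexive (sym degree[x]≡2)) (length-filter (x ∈?_) (lines S))
  nonempty : All Nonempty (lines S)
  nonempty = All.map (λ {l} ∣l∣≡r → 0<∣p∣⇒Nonempty l (≤-trans (1≤lineSize (lines S) two-lines uniform intersecting)
                                                               (≤-reflexive (sym ∣l∣≡r)))) uniform
  τ≤⌈m/2⌉ : t ≤ ⌈ m /2⌉
  τ≤⌈m/2⌉ with pairing-transversal (lines S) (AllPairs.map (∣p∩q∣≡1⇒Nonempty _ _) intersecting) nonempty
  ... | T , hits , ∣T∣≤ = ≤-trans (minimal T (λ _ → All.lookup hits)) ∣T∣≤
  counting : m * r ≤ n + m C 2
  counting = ≤-trans (length*r≤∣⋃∣+lengthC2 (lines S) (linear S) uniform) (+-monoˡ-≤ (m C 2) (∣p∣≤n (⋃ (lines S))))
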